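{- The only non-simple $\theta$-free matching covered graph is $C_2$.
   Context: Graphs loopless; multiple edges allowed; a graph is simple if it has no parallel edges. $C_2$ is two vertices joined by two parallel edges, $\theta$ is two vertices joined by three parallel edges. A connected graph with at least two vertices is matching covered if every edge lies in a perfect matching. A subgraph $H$ of $G$ is conformal if $G-V(H)$ has a perfect matching; $G$ is $\theta$-free if it has no conformal subgraph that is a bisubdivision of $\theta$ (obtained by replacing some edges of $\theta$ by paths with an even number of internal vertices). -}

module Defs where

open import Data.Nat using (ℕ; zero; suc; _+_; _≤_)
open import Data.Fin using (Fin; zero; suc; fromℕ; inject₁)
open import Data.Product using (Σ; ∃; ∃-syntax; _×_; _,_; proj₁; proj₂; swap)
open import Data.Sum using (_⊎_)
open import Data.Empty using (⊥)
open import Data.Bool using (Bool; true)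
open import Relation.Nullary using (¬_)
open import Relation.Binary.PropositionalEquality using (_≡_; _≢_)
open import Function.Bundles using (_↔_; Inverse)

-- A finite loopless multigraph: vertices Fin n, edges Fin m,
-- each edge has an (arbitrarily ordered) pair of distinct ends.
record Graph : Set where
  field
    n        : ℕ
    m        : ℕ
    ends     : Fin m → Fin n × Fin n
    loopless : ∀ e → proj₁ (ends e) ≢ proj₂ (ends e)
open Graph public

module _ (G : Graph) where

  Joins : Fin (m G) → Fin (n G) → Fin (n G) → Set
  Joins e u v = (ends G e ≡ (u , v)) ⊎ (ends G e ≡ (v , u))

  Incident : Fin (n G) → Fin (m G) → Set
  Incident v e = (proj₁ (ends G e) ≡ v) ⊎ (proj₂ (ends G e) ≡ v)

  Parallel : Fin (m G) → Fin (m G) → Set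
  Parallel e f = e ≢ f × ((ends G e ≡ ends G f) ⊎ (ends G e ≡ swap (ends G f)))

  IsSimple : Set
  IsSimple = ∀ e f → ¬ Parallel e f

  data Reach : Fin (n G) → Fin (n G) → Set where
    here : ∀ {u} → Reach u u
    step : ∀ {u v w} (e : Fin (m G)) → Joins e u v → Reach v w → Reach u w

  Connected : Set
  Connected = ∀ u v → Reach u v

  -- M (a set of edges, given by its indicator) is a perfect matching of the subgraph of G
  -- induced by the vertex set X.
  record PerfectMatchingOn (X : Fin (n G) → Set) (M : Fin (m G) → Bool) : Set where
    field
      inside : ∀ e → M e ≡ true → X (proj₁ (ends G e)) × X (proj₂ (ends G e))
      cover  : ∀ v → X v →
               ∃[ e ] (M e ≡ true × Incident v e ×
                       (∀ e′ → M e′ ≡ true → Incident v e′ → e′ ≡ e))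

  AllVertices : Fin (n G) → Set
  AllVertices _ = Data.Unit.⊤
    where import Data.Unit

  PerfectMatching : (Fin (m G) → Bool) → Set
  PerfectMatching M = PerfectMatchingOn AllVertices M

  MatchingCovered : Set
  MatchingCovered =
    (2 ≤ n G) × Connected ×
    (∀ e → ∃[ M ] (PerfectMatching M × M e ≡ true))

  record Path (a b : Fin (n G)) (k : ℕ) : Set where
    field
      verts : Fin (suc k) → Fin (n G)
      edges : Fin k → Fin (m G)
      start : verts zero ≡ a
      end   : verts (fromℕ k) ≡ b
      link  : ∀ i → Joins (edges i) (verts (inject₁ i)) (verts (suc i))
      injV  : ∀ i j → verts i ≡ verts j → i ≡ j

  OnPath : ∀ {a b k} → Path a b k → Fin (n G) → Set
  OnPath P v = ∃[ i ] (Path.verts P i ≡ v)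

  HasEdge : ∀ {a b k} → Path a b k → Fin (m G) → Set
  HasEdge P e = ∃[ i ] (Path.edges P i ≡ e)

Odd : ℕ → Set
Odd k = ∃[ j ] (k ≡ suc (j + j))

module _ (G : Graph) where

  -- A subgraph of G that is a bisubdivision of θ: two branch vertices a, b
  -- joined by three internally disjoint, edge-disjoint paths of odd length
  -- (each edge of θ replaced by a path with an even number of internal vertices).
  record ThetaBisubdivision : Set where
    field
      a b : Fin (n G)
      k₁ k₂ k₃ : ℕ
      P₁ : Path G a b k₁
      P₂ : Path G a b k₂
      P₃ : Path G a b k₃
      odd₁ : Odd k₁
      odd₂ : Odd k₂
      odd₃ : Odd k₃
      int₁₂ : ∀ v → OnPath G P₁ v → OnPath G P₂ v → (v ≡ a) ⊎ (v ≡ b)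
      int₁₃ : ∀ v → OnPath G P₁ v → OnPath G P₃ v → (v ≡ a) ⊎ (v ≡ b)
      int₂₃ : ∀ v → OnPath G P₂ v → OnPath G P₃ v → (v ≡ a) ⊎ (v ≡ b)
      edj₁₂ : ∀ e → HasEdge G P₁ e → HasEdge G P₂ e → ⊥
      edj₁₃ : ∀ e → HasEdge G P₁ e → HasEdge G P₃ e → ⊥
      edj₂₃ : ∀ e → HasEdge G P₂ e → HasEdge G P₃ e → ⊥

    InH : Fin (n G) → Set
    InH v = OnPath G P₁ v ⊎ OnPath G P₂ v ⊎ OnPath G P₃ v

  Conformal : ThetaBisubdivision → Set
  Conformal H =
    ∃[ M ] PerfectMatchingOn G (λ v → ¬ ThetaBisubdivision.InH H v) M

  ThetaFree : Set
  ThetaFree = ¬ (Σ ThetaBisubdivision Conformal)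

C₂ : Graph
C₂ = record
  { n = 2 ; m = 2
  ; ends = λ _ → (zero , suc zero)
  ; loopless = λ _ () }

record _≅_ (G H : Graph) : Set where
  field
    vmap : Fin (n G) ↔ Fin (n H)
    emap : Fin (m G) ↔ Fin (m H)
  open Inverse vmap renaming (to to fv)
  open Inverse emap renaming (to to fe)
  field
    preserves : ∀ e → Joins H (fe e) (fv (proj₁ (ends G e))) (fv (proj₂ (ends G e)))

{-# OPTIONS --safe #-}
-- Let e, f be parallel edges joining u and v. If G has a third vertex, connectivity gives an
-- edge g from u (say) to a vertex w ∉ {u, v}. For perfect matchings A ∋ g and B ∋ e, the
-- A/B-alternating cycle through u contains g and e; removing e leaves an odd u–v path Q that
-- avoids e and f. So e, f and Q form a bisubdivision of θ, and since V(Q) is closed under the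
-- A-mate map, A restricts to a perfect matching of G − V(Q). If G has only the vertices u and v,
-- a third edge would form θ itself; hence G has just e and f, i.e. G ≅ C₂. Conversely C₂ has too
-- few edges to contain θ.
module Submission where

open import Defs
open import Data.Product using (_×_)
open import Relation.Nullary using (¬_)

open import Data.Bool using (Bool; true; false; not; _∧_)
open import Data.Bool.Properties using (not-¬; ¬-not; not-involutive; T-≡) renaming (_≟_ to _≟ᵇ_)
open import Data.Empty using (⊥; ⊥-elim)
open import Data.Fin using (Fin; zero; suc; toℕ; fromℕ; fromℕ<)
open import Data.Fin.Properties
  using (toℕ-injective; toℕ-fromℕ; toℕ-fromℕ<; toℕ-inject₁; toℕ<n; pigeonhole; any?)
  renaming (_≟_ to _≟ᶠ_)
open import Data.Nat using (ℕ; zero; suc; _≤_; _<_; z≤n; s≤s)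
open import Data.Nat.Properties
  using (≤-refl; ≤-pred; <⇒≤; <-≤-trans; <-irrefl; <-cmp; ≤∧≢⇒<; m≤n⇒m<n∨m≡n; n<1+n; +-suc;
         anyUpTo?)
open import Data.Product using (Σ; ∃; ∃-syntax; _,_; proj₁; proj₂; swap)
open import Data.Product.Properties using (,-injective; ≡-dec)
open import Data.Sum using (_⊎_; inj₁; inj₂; [_,_])
open import Data.Unit using (tt)
open import Function using (_∘_)
open import Function.Bundles using (Equivalence)
open import Function.Construct.Identity using (↔-id)
open import Relation.Binary using (tri<; tri≈; tri>)
open import Relation.Binary.PropositionalEquality
  using (_≡_; _≢_; refl; sym; trans; cong; cong₂; subst)
open import Relation.Nullary using (Dec; yes; no; does; ¬?; contradiction)
open import Relation.Nullary.Decidable using (_×-dec_; _⊎-dec_; dec-true; dec-false; isYes≗does; toWitness)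
open import Relation.Unary using (Decidable)

oddᵇ : ℕ → Bool
oddᵇ zero    = false
oddᵇ (suc n) = not (oddᵇ n)

oddᵇ⇒Odd : ∀ n → oddᵇ n ≡ true → Odd n
oddᵇ⇒Odd (suc zero)    _ = 0 , refl
oddᵇ⇒Odd (suc (suc n)) p with oddᵇ⇒Odd n (trans (sym (not-involutive (oddᵇ n))) p)
... | j , refl = suc j , cong (λ (k : ℕ) → suc (suc k)) (sym (+-suc j j))

module _ {P : ℕ → Set} (P? : Decidable P) where

  least-witness-below : ∀ b → ∃[ n ] (n < b × P n) → ∃[ n ] (P n × ∀ {k} → k < n → ¬ P k)
  least-witness-below (suc b) (n , n<1+b , Pn) with anyUpTo? P? b
  ... | yes earlier = least-witness-below b earlier
  ... | no none     = n , Pn , λ k<n Pk → none (_ , <-≤-trans k<n (≤-pred n<1+b) , Pk)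

  least-witness : ∃ P → ∃[ n ] (P n × ∀ {k} → k < n → ¬ P k)
  least-witness (n , Pn) = least-witness-below (suc n) (n , ≤-refl , Pn)

InjectiveUpTo : {A : Set} → ℕ → (ℕ → A) → Set
InjectiveUpTo k f = ∀ {i j} → i ≤ k → j ≤ k → f i ≡ f j → i ≡ j

distinct₂⇒2≤ : ∀ {N} {x y : Fin N} → x ≢ y → 2 ≤ N
distinct₂⇒2≤ {suc (suc _)}               _   = s≤s (s≤s z≤n)
distinct₂⇒2≤ {suc zero} {zero} {zero} x≢y = ⊥-elim (x≢y refl)

Fin2-cover : ∀ {N} → N ≡ 2 → {a b : Fin N} → a ≢ b → ∀ y → (y ≡ a) ⊎ (y ≡ b)
Fin2-cover refl {zero}     {zero}     a≢b _          = ⊥-elim (a≢b refl)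
Fin2-cover refl {zero}     {suc zero} _   zero       = inj₁ refl
Fin2-cover refl {zero}     {suc zero} _   (suc zero) = inj₂ refl
Fin2-cover refl {suc zero} {zero}     _   zero       = inj₂ refl
Fin2-cover refl {suc zero} {zero}     _   (suc zero) = inj₁ refl
Fin2-cover refl {suc zero} {suc zero} a≢b _          = ⊥-elim (a≢b refl)

distinct₃⇒3≤ : ∀ {N} {x y z : Fin N} → x ≢ y → x ≢ z → y ≢ z → 3 ≤ N
distinct₃⇒3≤ {suc (suc (suc _))} _ _ _ = s≤s (s≤s (s≤s z≤n))
distinct₃⇒3≤ {1} {zero}     {zero}                x≢y _   _   = ⊥-elim (x≢y refl)
distinct₃⇒3≤ {2} {zero}     {zero}                x≢y _   _   = ⊥-elim (x≢y refl)
distinct₃⇒3≤ {2} {suc zero} {suc zero}            x≢y _   _   = ⊥-elim (x≢y refl)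
distinct₃⇒3≤ {2} {zero}     {suc zero} {zero}     _   x≢z _   = ⊥-elim (x≢z refl)
distinct₃⇒3≤ {2} {zero}     {suc zero} {suc zero} _   _   y≢z = ⊥-elim (y≢z refl)
distinct₃⇒3≤ {2} {suc zero} {zero}     {zero}     _   _   y≢z = ⊥-elim (y≢z refl)
distinct₃⇒3≤ {2} {suc zero} {zero}     {suc zero} _   x≢z _   = ⊥-elim (x≢z refl)

3≤⇒avoid-two : ∀ {N} → 3 ≤ N → (u v : Fin N) → ∃[ z ] (z ≢ u × z ≢ v)
3≤⇒avoid-two (s≤s (s≤s (s≤s _))) zero          zero          = suc zero , (λ ()) , (λ ())
3≤⇒avoid-two (s≤s (s≤s (s≤s _))) zero          (suc zero)    = suc (suc zero) , (λ ()) , (λ ())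
3≤⇒avoid-two (s≤s (s≤s (s≤s _))) zero          (suc (suc _)) = suc zero , (λ ()) , (λ ())
3≤⇒avoid-two (s≤s (s≤s (s≤s _))) (suc zero)    zero          = suc (suc zero) , (λ ()) , (λ ())
3≤⇒avoid-two (s≤s (s≤s (s≤s _))) (suc zero)    (suc _)       = zero , (λ ()) , (λ ())
3≤⇒avoid-two (s≤s (s≤s (s≤s _))) (suc (suc _)) zero          = suc zero , (λ ()) , (λ ())
3≤⇒avoid-two (s≤s (s≤s (s≤s _))) (suc (suc _)) (suc _)       = zero , (λ ()) , (λ ())

-- α and β stand for the mate maps of two perfect matchings, so walk traces the
-- alternating cycle through x.
module AlternatingWalk {N : ℕ} (α β : Fin N → Fin N)
  (α-involutive : ∀ y → α (α y) ≡ y) (β-involutive : ∀ y → β (β y) ≡ y)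
  (α-≢ : ∀ y → α y ≢ y) (β-≢ : ∀ y → β y ≢ y) (x : Fin N) where

  move : Bool → Fin N → Fin N
  move false = α
  move true  = β

  move-involutive : ∀ b y → move b (move b y) ≡ y
  move-involutive false = α-involutive
  move-involutive true  = β-involutive

  move-≢ : ∀ b y → move b y ≢ y
  move-≢ false = α-≢
  move-≢ true  = β-≢

  walk : ℕ → Fin N
  walk zero    = x
  walk (suc t) = move (oddᵇ t) (walk t)

  walk-back : ∀ t → move (oddᵇ t) (walk (suc t)) ≡ walk t
  walk-back t = move-involutive (oddᵇ t) (walk t)

  step-back : ∀ t {b y} → b ≡ oddᵇ t → y ≡ walk (suc t) → move b y ≡ walk t
  step-back t refl refl = walk-back t

  Returns : ℕ → Set
  Returns t = ∃[ s ] (s < suc t × walk s ≡ walk (suc t))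

  returns? : Decidable Returns
  returns? t = anyUpTo? (λ s → walk s ≟ᶠ walk (suc t)) (suc t)

  eventually-returns : ∃ Returns
  eventually-returns with pigeonhole (n<1+n N) (walk ∘ toℕ)
  ... | i , suc j , i<j , eq = toℕ j , toℕ i , i<j , eq

  NoReturnBefore : ℕ → Set
  NoReturnBefore t = ∀ {t′} → t′ < t → ¬ Returns t′

  no-repeat-before-return : ∀ {t} → NoReturnBefore t → ∀ {i j} → i < j → j ≤ t → walk i ≢ walk j
  no-repeat-before-return early {j = suc j} i<j j≤t eq = early j≤t (_ , i<j , eq)

  injective-before-return : ∀ {t} → NoReturnBefore t → InjectiveUpTo t walk
  injective-before-return early {i} {j} i≤t j≤t eq with <-cmp i j
  ... | tri< i<j _ _ = ⊥-elim (no-repeat-before-return early i<j j≤t eq)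
  ... | tri≈ _ i≡j _ = i≡j
  ... | tri> _ _ j<i = ⊥-elim (no-repeat-before-return early j<i i≤t (sym eq))

  return-to-start : ∀ {t} b → oddᵇ t ≡ b → walk t ≡ move b x → InjectiveUpTo t walk →
                    oddᵇ t ≡ true × walk t ≡ β x
  return-to-start             true  odd-t eq _   = odd-t , eq
  return-to-start {zero}      false _     eq _   = ⊥-elim (α-≢ x (sym eq))
  return-to-start {suc t}     false odd-t eq inj with inj ≤-refl (s≤s z≤n) eq
  ... | refl = contradiction odd-t λ ()

  -- Stepping back from a repeat walk (1 + s) ≡ walk (1 + t) along the matching used at
  -- time t gives walk s ≡ walk t if s and t have the same parity and walk (2 + s) ≡ walk t
  -- otherwise; both contradict injectivity up to t.
  no-shifted-return : ∀ {s t} → s < t → oddᵇ (suc s) ≡ oddᵇ t → walk (suc s) ≡ walk (suc t) →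
                      InjectiveUpTo t walk → ⊥
  no-shifted-return {s} {t} s<t same eq inj with m≤n⇒m<n∨m≡n s<t
  ... | inj₂ refl = move-≢ (oddᵇ t) (walk t) (sym eq)
  ... | inj₁ 1+s<t with inj 1+s<t ≤-refl (step-back t same eq)
  ...   | refl = not-¬ refl same

  no-later-return : ∀ {s t} → suc s < suc t → walk (suc s) ≡ walk (suc t) → InjectiveUpTo t walk → ⊥
  no-later-return {s} {t} (s≤s s<t) eq inj with oddᵇ s ≟ᵇ oddᵇ t
  ... | yes same = <-irrefl (inj (<⇒≤ s<t) ≤-refl (trans (sym (walk-back s)) (step-back t same eq))) s<t
  ... | no differ = no-shifted-return s<t (sym (¬-not (differ ∘ sym))) eq inj

  record Closing : Set where
    field
      time           : ℕ
      time-odd       : oddᵇ time ≡ true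
      walk-time      : walk time ≡ β x
      walk-injective : InjectiveUpTo time walk

  closing : Closing
  closing with least-witness returns? eventually-returns
  ... | t , (zero , _ , x≡walk[1+t]) , early =
    let inj            = injective-before-return early
        odd-t , walk-t = return-to-start (oddᵇ t) refl (sym (step-back t refl x≡walk[1+t])) inj
    in  record { time = t ; time-odd = odd-t ; walk-time = walk-t ; walk-injective = inj }
  ... | t , (suc s , s<t , eq) , early = ⊥-elim (no-later-return s<t eq (injective-before-return early))

  α-closed : ∀ {t} i → oddᵇ t ≡ true → i ≤ t → ∃[ j ] (j ≤ t × walk j ≡ α (walk i))
  α-closed {zero}  zero    () _
  α-closed {suc t} zero    _     _   = 1 , s≤s z≤n , refl
  α-closed         (suc i) odd-t i<t with oddᵇ i ≟ᵇ true
  ... | no even-i = i , <⇒≤ i<t , sym (step-back i (sym (¬-not even-i)) refl)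
  ... | yes odd-i = suc (suc i) , ≤∧≢⇒< i<t 1+i≢t , cong (λ b → move (not b) (walk (suc i))) odd-i
    where
    1+i≢t : suc i ≢ _
    1+i≢t refl = contradiction (trans (sym odd-t) (cong not odd-i)) λ ()

module GraphProperties (G : Graph) where

  Joins-sym : ∀ {h a b} → Joins G h a b → Joins G h b a
  Joins-sym (inj₁ p) = inj₂ p
  Joins-sym (inj₂ p) = inj₁ p

  Joins-ends : ∀ {h a b c d} → Joins G h a b → Joins G h c d → (a ≡ c × b ≡ d) ⊎ (a ≡ d × b ≡ c)
  Joins-ends (inj₁ p) (inj₁ q) = inj₁ (,-injective (trans (sym p) q))
  Joins-ends (inj₁ p) (inj₂ q) = inj₂ (,-injective (trans (sym p) q))
  Joins-ends (inj₂ p) (inj₁ q) = inj₂ (swap (,-injective (trans (sym p) q)))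
  Joins-ends (inj₂ p) (inj₂ q) = inj₁ (swap (,-injective (trans (sym p) q)))

  Joins-functional : ∀ {h a b b′} → Joins G h a b → Joins G h a b′ → b ≡ b′
  Joins-functional h-ab h-ab′ with Joins-ends h-ab h-ab′
  ... | inj₁ (_ , b≡b′)      = b≡b′
  ... | inj₂ (a≡b′ , b≡a)    = trans b≡a a≡b′

  Joins⇒Incident : ∀ {h a b} → Joins G h a b → Incident G a h
  Joins⇒Incident (inj₁ p) = inj₁ (cong proj₁ p)
  Joins⇒Incident (inj₂ p) = inj₂ (cong proj₂ p)

  Incident⇒Joins : ∀ {a h} → Incident G a h → ∃[ b ] Joins G h a b
  Incident⇒Joins {h = h} (inj₁ p) = _ , inj₁ (cong (_, proj₂ (ends G h)) p)
  Incident⇒Joins {h = h} (inj₂ p) = _ , inj₂ (cong (proj₁ (ends G h) ,_) p)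

  Joins⇒≢ : ∀ {h a b} → Joins G h a b → a ≢ b
  Joins⇒≢ {h} (inj₁ p) a≡b = loopless G h (trans (cong proj₁ p) (trans a≡b (sym (cong proj₂ p))))
  Joins⇒≢ {h} (inj₂ p) a≡b = loopless G h (trans (cong proj₁ p) (trans (sym a≡b) (sym (cong proj₂ p))))

  Joins-first-end : ∀ {h a b} → Joins G h a b → (proj₁ (ends G h) ≡ a) ⊎ (proj₁ (ends G h) ≡ b)
  Joins-first-end (inj₁ p) = inj₁ (cong proj₁ p)
  Joins-first-end (inj₂ p) = inj₂ (cong proj₁ p)

  Parallel⇒Joins : ∀ {e f} → Parallel G e f → Joins G f (proj₁ (ends G e)) (proj₂ (ends G e))
  Parallel⇒Joins (_ , inj₁ p) = inj₁ (sym p)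
  Parallel⇒Joins (_ , inj₂ p) = inj₂ (sym (cong swap p))

  Parallel? : ∀ e f → Dec (Parallel G e f)
  Parallel? e f = ¬? (e ≟ᶠ f) ×-dec (ends G e ≟ₚ ends G f ⊎-dec ends G e ≟ₚ swap (ends G f))
    where _≟ₚ_ = ≡-dec _≟ᶠ_ _≟ᶠ_

  ¬IsSimple⇒parallel-edges : ¬ IsSimple G →
                             ∃[ e ] ∃[ f ] ∃[ u ] ∃[ v ] (e ≢ f × Joins G e u v × Joins G f u v)
  ¬IsSimple⇒parallel-edges non-simple with any? (λ e → any? (Parallel? e))
  ... | yes (e , f , e∥f@(e≢f , _)) = e , f , _ , _ , e≢f , inj₁ refl , Parallel⇒Joins e∥f
  ... | no  none                    = ⊥-elim (non-simple λ e f e∥f → none (e , f , e∥f))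

  Reach-exit : ∀ {S : Fin (n G) → Set} {x z} → Decidable S → Reach G x z → S x → ¬ S z →
               ∃[ h ] ∃[ a ] ∃[ b ] (S a × ¬ S b × Joins G h a b)
  Reach-exit S? here            Sx ¬Sz = ⊥-elim (¬Sz Sx)
  Reach-exit S? (step {v = y} h h-xy y↝z) Sx ¬Sz with S? y
  ... | yes Sy = Reach-exit S? y↝z Sy ¬Sz
  ... | no ¬Sy = h , _ , y , Sx , ¬Sy , h-xy

module SeqPath {G : Graph} (vs : ℕ → Fin (n G)) (es : ℕ → Fin (m G)) {k : ℕ}
         (link : ∀ {i} → i < k → Joins G (es i) (vs i) (vs (suc i)))
         (injective : InjectiveUpTo k vs) {b : Fin (n G)} (vs[k]≡b : vs k ≡ b) where

  seqPath : Path G (vs 0) b k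
  seqPath = record
    { verts = vs ∘ toℕ
    ; edges = es ∘ toℕ
    ; start = refl
    ; end   = trans (cong vs (toℕ-fromℕ k)) vs[k]≡b
    ; link  = λ i → subst (λ j → Joins G (es (toℕ i)) (vs j) (vs (suc (toℕ i))))
                          (sym (toℕ-inject₁ i)) (link (toℕ<n i))
    ; injV  = λ i j eq → toℕ-injective (injective (≤-pred (toℕ<n i)) (≤-pred (toℕ<n j)) eq)
    }

  seqPath-OnPath : ∀ {y} → OnPath G seqPath y → ∃[ i ] (i ≤ k × vs i ≡ y)
  seqPath-OnPath (i , vs[i]≡y) = toℕ i , ≤-pred (toℕ<n i) , vs[i]≡y

  OnPath-seqPath : ∀ {i} → i ≤ k → OnPath G seqPath (vs i)
  OnPath-seqPath i≤k = fromℕ< (s≤s i≤k) , cong vs (toℕ-fromℕ< (s≤s i≤k))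

  seqPath-HasEdge : ∀ {h} → HasEdge G seqPath h → ∃[ i ] (i < k × es i ≡ h)
  seqPath-HasEdge (i , es[i]≡h) = toℕ i , toℕ<n i , es[i]≡h

module EdgePath {G : Graph} {h : Fin (m G)} {a b : Fin (n G)} (h-ab : Joins G h a b) where
  open GraphProperties G

  private
    endpoints : ℕ → Fin (n G)
    endpoints zero    = a
    endpoints (suc _) = b

    endpoints-injective : InjectiveUpTo 1 endpoints
    endpoints-injective {zero}  {zero}  _ _ _   = refl
    endpoints-injective {zero}  {suc _} _ (s≤s z≤n) a≡b = ⊥-elim (Joins⇒≢ h-ab a≡b)
    endpoints-injective {suc _} {zero}  (s≤s z≤n) _ b≡a = ⊥-elim (Joins⇒≢ h-ab (sym b≡a))
    endpoints-injective {suc _} {suc _} (s≤s z≤n) (s≤s z≤n) _ = refl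

    endpoints-link : ∀ {i} → i < 1 → Joins G h (endpoints i) (endpoints (suc i))
    endpoints-link (s≤s z≤n) = h-ab

  open SeqPath {G} endpoints (λ _ → h) endpoints-link endpoints-injective refl

  edgePath : Path G a b 1
  edgePath = seqPath

  edgePath-OnPath : ∀ {y} → OnPath G edgePath y → (y ≡ a) ⊎ (y ≡ b)
  edgePath-OnPath y∈P with seqPath-OnPath y∈P
  ... | zero  , _ , a≡y = inj₁ (sym a≡y)
  ... | suc _ , _ , b≡y = inj₂ (sym b≡y)

  edgePath-HasEdge : ∀ {h′} → HasEdge G edgePath h′ → h ≡ h′
  edgePath-HasEdge (_ , h≡h′) = h≡h′

module Mate {G : Graph} {M : Fin (m G) → Bool} (perfect : PerfectMatching G M) where
  open PerfectMatchingOn perfect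
  open GraphProperties G

  mateEdge : Fin (n G) → Fin (m G)
  mateEdge y = proj₁ (cover y tt)

  mateEdge∈M : ∀ y → M (mateEdge y) ≡ true
  mateEdge∈M y = proj₁ (proj₂ (cover y tt))

  mateEdge-unique : ∀ {y h} → M h ≡ true → Incident G y h → h ≡ mateEdge y
  mateEdge-unique {y} h∈M y∈h = proj₂ (proj₂ (proj₂ (cover y tt))) _ h∈M y∈h

  mate : Fin (n G) → Fin (n G)
  mate y = proj₁ (Incident⇒Joins (proj₁ (proj₂ (proj₂ (cover y tt)))))

  mateEdge-joins : ∀ y → Joins G (mateEdge y) y (mate y)
  mateEdge-joins y = proj₂ (Incident⇒Joins (proj₁ (proj₂ (proj₂ (cover y tt)))))

  mate-unique : ∀ {h y z} → M h ≡ true → Joins G h y z → z ≡ mate y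
  mate-unique {y = y} h∈M h-yz =
    Joins-functional (subst (λ h → Joins G h _ _) (mateEdge-unique h∈M (Joins⇒Incident h-yz)) h-yz)
                     (mateEdge-joins y)

  mate-involutive : ∀ y → mate (mate y) ≡ y
  mate-involutive y = sym (mate-unique (mateEdge∈M y) (Joins-sym (mateEdge-joins y)))

  mate-≢ : ∀ y → mate y ≢ y
  mate-≢ y = Joins⇒≢ (mateEdge-joins y) ∘ sym

module _ {G : Graph} {S : Fin (n G) → Set} (S? : Decidable S) where

  -- An edge is kept iff its first end lies outside S; for a mate-closed S this
  -- keeps exactly the M-edges with both ends outside S.
  restrict : (Fin (m G) → Bool) → Fin (m G) → Bool
  restrict M h = not (does (S? (proj₁ (ends G h)))) ∧ M h

  module _ {M : Fin (m G) → Bool} (perfect : PerfectMatching G M) where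
    open GraphProperties G using (Joins-first-end; Joins⇒Incident)
    open Mate perfect

    restrict-true : ∀ {h} → not (does (S? (proj₁ (ends G h)))) ∧ M h ≡ true →
                    ¬ S (proj₁ (ends G h)) × M h ≡ true
    restrict-true {h} with S? (proj₁ (ends G h))
    ... | yes _  = λ ()
    ... | no ¬S₁ = λ h∈M → ¬S₁ , h∈M

    restrict-≡ : ∀ {h} → ¬ S (proj₁ (ends G h)) → restrict M h ≡ M h
    restrict-≡ {h} ¬S₁ = cong (λ b → not b ∧ M h) (dec-false (S? (proj₁ (ends G h))) ¬S₁)

    restrict-perfect : (∀ {y} → S y → S (mate y)) → PerfectMatchingOn G (λ y → ¬ S y) (restrict M)
    restrict-perfect closed = record { inside = inside ; cover = cover }
      where
      ¬S-mate : ∀ {y} → ¬ S y → ¬ S (mate y)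
      ¬S-mate {y} ¬Sy S[mate-y] = ¬Sy (subst S (mate-involutive y) (closed S[mate-y]))

      inside : ∀ h → restrict M h ≡ true → ¬ S (proj₁ (ends G h)) × ¬ S (proj₂ (ends G h))
      inside h h∈M′ =
        let ¬S₁ , h∈M = restrict-true h∈M′
        in  ¬S₁ , subst (λ z → ¬ S z) (sym (mate-unique h∈M (inj₁ refl))) (¬S-mate ¬S₁)

      cover : ∀ y → ¬ S y → ∃[ h ] (restrict M h ≡ true × Incident G y h ×
                                    (∀ h′ → restrict M h′ ≡ true → Incident G y h′ → h′ ≡ h))
      cover y ¬Sy =
        mateEdge y , trans (restrict-≡ ¬S₁) (mateEdge∈M y) , Joins⇒Incident (mateEdge-joins y) ,
        λ h′ h′∈M′ y∈h′ → mateEdge-unique (proj₂ (restrict-true h′∈M′)) y∈h′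
        where
        ¬S₁ : ¬ S (proj₁ (ends G (mateEdge y)))
        ¬S₁ with Joins-first-end (mateEdge-joins y)
        ... | inj₁ first≡y      = subst (λ z → ¬ S z) (sym first≡y) ¬Sy
        ... | inj₂ first≡mate-y = subst (λ z → ¬ S z) (sym first≡mate-y) (¬S-mate ¬Sy)

module _ {G : Graph} where

  OnPath? : ∀ {a b k} (P : Path G a b k) → Decidable (OnPath G P)
  OnPath? P y = any? (λ i → Path.verts P i ≟ᶠ y)

  OnPath-endpoint : ∀ {a b k y} (P : Path G a b k) → (y ≡ a) ⊎ (y ≡ b) → OnPath G P y
  OnPath-endpoint P (inj₁ refl) = zero , Path.start P
  OnPath-endpoint P (inj₂ refl) = fromℕ _ , Path.end P

  Path-firstEdge : ∀ {a b k} (P : Path G a b k) → Odd k → ∃ (HasEdge G P)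
  Path-firstEdge P (_ , refl) = _ , zero , refl

  HasEdge-disjoint : ∀ {a b k a′ b′ k′} (P : Path G a b k) (P′ : Path G a′ b′ k′) {h h′} →
                     (∀ x → HasEdge G P x → HasEdge G P′ x → ⊥) →
                     HasEdge G P h → HasEdge G P′ h′ → h ≢ h′
  HasEdge-disjoint _ _ disjoint h∈P h′∈P′ refl = disjoint _ h∈P h′∈P′

  module _ (H : ThetaBisubdivision G) where
    open ThetaBisubdivision H

    InH? : Decidable InH
    InH? y = OnPath? P₁ y ⊎-dec OnPath? P₂ y ⊎-dec OnPath? P₃ y

    spanning⇒Conformal : (∀ y → InH y) → Conformal G H
    spanning⇒Conformal spanning =
      (λ _ → false) , record { inside = λ _ () ; cover = λ y y∉H → ⊥-elim (y∉H (spanning y)) }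

    theta⇒3≤m : 3 ≤ m G
    theta⇒3≤m =
      distinct₃⇒3≤ (HasEdge-disjoint P₁ P₂ edj₁₂ h₁∈P₁ h₂∈P₂)
                   (HasEdge-disjoint P₁ P₃ edj₁₃ h₁∈P₁ h₃∈P₃)
                   (HasEdge-disjoint P₂ P₃ edj₂₃ h₂∈P₂ h₃∈P₃)
      where
      h₁∈P₁ = proj₂ (Path-firstEdge P₁ odd₁)
      h₂∈P₂ = proj₂ (Path-firstEdge P₂ odd₂)
      h₃∈P₃ = proj₂ (Path-firstEdge P₃ odd₃)

module ParallelTheta {G : Graph} {e f : Fin (m G)} {a b : Fin (n G)}
         (e≢f : e ≢ f) (e-ab : Joins G e a b) (f-ab : Joins G f a b)
         {k : ℕ} (Q : Path G a b k) (odd : Odd k) (e∉Q : ¬ HasEdge G Q e) (f∉Q : ¬ HasEdge G Q f) where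

  private
    module E = EdgePath {G} e-ab
    module F = EdgePath {G} f-ab

  theta : ThetaBisubdivision G
  theta = record
    { a = a ; b = b ; k₁ = 1 ; k₂ = 1 ; k₃ = k
    ; P₁ = E.edgePath ; P₂ = F.edgePath ; P₃ = Q
    ; odd₁ = 0 , refl ; odd₂ = 0 , refl ; odd₃ = odd
    ; int₁₂ = λ _ y∈P₁ _ → E.edgePath-OnPath y∈P₁
    ; int₁₃ = λ _ y∈P₁ _ → E.edgePath-OnPath y∈P₁
    ; int₂₃ = λ _ y∈P₂ _ → F.edgePath-OnPath y∈P₂
    ; edj₁₂ = λ _ h∈P₁ h∈P₂ →
                e≢f (trans (E.edgePath-HasEdge h∈P₁) (sym (F.edgePath-HasEdge h∈P₂)))
    ; edj₁₃ = λ _ h∈P₁ h∈Q → e∉Q (subst (HasEdge G Q) (sym (E.edgePath-HasEdge h∈P₁)) h∈Q)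
    ; edj₂₃ = λ _ h∈P₂ h∈Q → f∉Q (subst (HasEdge G Q) (sym (F.edgePath-HasEdge h∈P₂)) h∈Q)
    }

  InH⇒OnPath : ∀ {y} → ThetaBisubdivision.InH theta y → OnPath G Q y
  InH⇒OnPath (inj₁ y∈P₁)        = OnPath-endpoint Q (E.edgePath-OnPath y∈P₁)
  InH⇒OnPath (inj₂ (inj₁ y∈P₂)) = OnPath-endpoint Q (F.edgePath-OnPath y∈P₂)
  InH⇒OnPath (inj₂ (inj₂ y∈Q))  = y∈Q

module ConformalTheta {G : Graph} {A B : Fin (m G) → Bool}
         (A-perfect : PerfectMatching G A) (B-perfect : PerfectMatching G B)
         {u v w : Fin (n G)} {e f g : Fin (m G)}
         (e≢f : e ≢ f) (e-uv : Joins G e u v) (f-uv : Joins G f u v) (e∈B : B e ≡ true)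
         (g-uw : Joins G g u w) (g∈A : A g ≡ true) (w≢v : w ≢ v) where
  open GraphProperties G using (Joins-ends)
  private
    module A = Mate A-perfect
    module B = Mate B-perfect
  open AlternatingWalk A.mate B.mate A.mate-involutive B.mate-involutive A.mate-≢ B.mate-≢ u
  open Closing closing renaming (time to T)

  matchEdge : Bool → Fin (n G) → Fin (m G)
  matchEdge false = A.mateEdge
  matchEdge true  = B.mateEdge

  matchEdge-joins : ∀ b y → Joins G (matchEdge b y) y (move b y)
  matchEdge-joins false = A.mateEdge-joins
  matchEdge-joins true  = B.mateEdge-joins

  walk-link : ∀ {i} → i < T → Joins G (matchEdge (oddᵇ i) (walk i)) (walk i) (walk (suc i))
  walk-link {i} _ = matchEdge-joins (oddᵇ i) (walk i)

  walk[T]≡v : walk T ≡ v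
  walk[T]≡v = trans walk-time (sym (B.mate-unique e∈B e-uv))

  open SeqPath {G} walk (λ i → matchEdge (oddᵇ i) (walk i)) walk-link walk-injective walk[T]≡v
    renaming (seqPath to Q)

  -- Q starts with the A-edge towards w ≠ v and only reaches v at its end.
  Q-step-not-uv : ∀ {i} → i < T →
                  ¬ ((walk i ≡ u × walk (suc i) ≡ v) ⊎ (walk i ≡ v × walk (suc i) ≡ u))
  Q-step-not-uv i<T (inj₁ (walk[i]≡u , walk[1+i]≡v)) with walk-injective (<⇒≤ i<T) z≤n walk[i]≡u
  ... | refl = w≢v (trans (A.mate-unique g∈A g-uw) walk[1+i]≡v)
  Q-step-not-uv i<T (inj₂ (walk[i]≡v , _)) =
    <-irrefl (walk-injective (<⇒≤ i<T) ≤-refl (trans walk[i]≡v (sym walk[T]≡v))) i<T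

  Q-avoids : ∀ {h} → Joins G h u v → ¬ HasEdge G Q h
  Q-avoids h-uv h∈Q with seqPath-HasEdge h∈Q
  ... | i , i<T , refl = Q-step-not-uv i<T (Joins-ends (walk-link i<T) h-uv)

  Q-A-closed : ∀ {y} → OnPath G Q y → OnPath G Q (A.mate y)
  Q-A-closed y∈Q with seqPath-OnPath y∈Q
  ... | i , i≤T , refl with α-closed i time-odd i≤T
  ...   | j , j≤T , walk[j]≡α = subst (OnPath G Q) walk[j]≡α (OnPath-seqPath j≤T)

  private
    module Θ = ParallelTheta e≢f e-uv f-uv Q (oddᵇ⇒Odd T time-odd) (Q-avoids e-uv) (Q-avoids f-uv)

  InH-A-closed : ∀ {y} → ThetaBisubdivision.InH Θ.theta y → ThetaBisubdivision.InH Θ.theta (A.mate y)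
  InH-A-closed y∈H = inj₂ (inj₂ (Q-A-closed (Θ.InH⇒OnPath y∈H)))

  conformalTheta : Σ (ThetaBisubdivision G) (Conformal G)
  conformalTheta = Θ.theta , _ , restrict-perfect (InH? Θ.theta) A-perfect InH-A-closed

module _ {G : Graph} where
  open GraphProperties G

  EveryEdgeMatched : Set
  EveryEdgeMatched = ∀ h → ∃[ M ] (PerfectMatching G M × M h ≡ true)

  matched⇒conformalTheta : EveryEdgeMatched → ∀ {e f g u v w} →
                           e ≢ f → Joins G e u v → Joins G f u v → Joins G g u w → w ≢ v →
                           Σ (ThetaBisubdivision G) (Conformal G)
  matched⇒conformalTheta matched {e} {g = g} e≢f e-uv f-uv g-uw w≢v with matched g | matched e
  ... | _ , A-perfect , g∈A | _ , B-perfect , e∈B =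
    ConformalTheta.conformalTheta A-perfect B-perfect e≢f e-uv f-uv e∈B g-uw g∈A w≢v

  ≥3-vertices⇒conformalTheta : Connected G → EveryEdgeMatched → 3 ≤ n G →
                               ∀ {e f u v} → e ≢ f → Joins G e u v → Joins G f u v →
                               Σ (ThetaBisubdivision G) (Conformal G)
  ≥3-vertices⇒conformalTheta connected matched 3≤n {u = u} {v} e≢f e-uv f-uv
    with 3≤⇒avoid-two 3≤n u v
  ... | z , z≢u , z≢v
    with Reach-exit (λ y → (y ≟ᶠ u) ⊎-dec (y ≟ᶠ v)) (connected u z) (inj₁ refl) [ z≢u , z≢v ]
  ... | _ , _ , _ , inj₁ refl , w∉uv , g-uw =
    matched⇒conformalTheta matched e≢f e-uv f-uv g-uw (w∉uv ∘ inj₂)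
  ... | _ , _ , _ , inj₂ refl , w∉uv , g-vw =
    matched⇒conformalTheta matched e≢f (Joins-sym e-uv) (Joins-sym f-uv) g-vw (w∉uv ∘ inj₁)

  two-vertices⇒Joins : n G ≡ 2 → ∀ {e a b} → Joins G e a b → ∀ h → Joins G h a b
  two-vertices⇒Joins 2≡n e-ab h
    with Fin2-cover 2≡n (Joins⇒≢ e-ab) (proj₁ (ends G h))
       | Fin2-cover 2≡n (Joins⇒≢ e-ab) (proj₂ (ends G h))
  ... | inj₁ h₁≡a | inj₂ h₂≡b = inj₁ (cong₂ _,_ h₁≡a h₂≡b)
  ... | inj₂ h₁≡b | inj₁ h₂≡a = inj₂ (cong₂ _,_ h₁≡b h₂≡a)
  ... | inj₁ h₁≡a | inj₁ h₂≡a = ⊥-elim (loopless G h (trans h₁≡a (sym h₂≡a)))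
  ... | inj₂ h₁≡b | inj₂ h₂≡b = ⊥-elim (loopless G h (trans h₁≡b (sym h₂≡b)))

  -- Three parallel edges form θ itself, which spans G.
  ≥3-edges⇒conformalTheta : n G ≡ 2 → 3 ≤ m G →
                            ∀ {e f a b} → e ≢ f → Joins G e a b → Joins G f a b →
                            Σ (ThetaBisubdivision G) (Conformal G)
  ≥3-edges⇒conformalTheta 2≡n 3≤m {e} {f} e≢f e-ab f-ab with 3≤⇒avoid-two 3≤m e f
  ... | g , g≢e , g≢f = Θ.theta , spanning⇒Conformal Θ.theta spanning
    where
    module Q = EdgePath {G} (two-vertices⇒Joins 2≡n e-ab g)
    module Θ = ParallelTheta e≢f e-ab f-ab Q.edgePath (0 , refl)
                             (g≢e ∘ Q.edgePath-HasEdge) (g≢f ∘ Q.edgePath-HasEdge)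
    spanning : ∀ y → ThetaBisubdivision.InH Θ.theta y
    spanning y =
      inj₁ (OnPath-endpoint (ThetaBisubdivision.P₁ Θ.theta) (Fin2-cover 2≡n (Joins⇒≢ e-ab) y))

C₂-Joins : ∀ h (a b : Fin 2) → a ≢ b → Joins C₂ h a b
C₂-Joins _ zero       zero       a≢b = ⊥-elim (a≢b refl)
C₂-Joins _ zero       (suc zero) _   = inj₁ refl
C₂-Joins _ (suc zero) zero       _   = inj₂ refl
C₂-Joins _ (suc zero) (suc zero) a≢b = ⊥-elim (a≢b refl)

two-vertices-two-edges⇒≅C₂ : ∀ G → n G ≡ 2 → m G ≡ 2 → G ≅ C₂
two-vertices-two-edges⇒≅C₂ record { loopless = loopless } refl refl = record
  { vmap = ↔-id _ ; emap = ↔-id _ ; preserves = λ h → C₂-Joins h _ _ (loopless h) }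

C₂-Incident : ∀ y h → Incident C₂ y h
C₂-Incident zero       _ = inj₁ refl
C₂-Incident (suc zero) _ = inj₂ refl

C₂-connected : Connected C₂
C₂-connected a b with a ≟ᶠ b
... | yes refl = here
... | no  a≢b  = step zero (C₂-Joins zero a b a≢b) here

-- Every vertex of C₂ lies on every edge, so each single edge is a perfect matching.
C₂-matchingCovered : MatchingCovered C₂
C₂-matchingCovered =
  s≤s (s≤s z≤n) , C₂-connected ,
  λ h → (λ h′ → does (h′ ≟ᶠ h)) , single h , dec-true (h ≟ᶠ h) refl
  where
  single : ∀ h → PerfectMatching C₂ (λ h′ → does (h′ ≟ᶠ h))
  single h = record
    { inside = λ _ _ → tt , tt
    ; cover  = λ y _ → h , dec-true (h ≟ᶠ h) refl , C₂-Incident y h ,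
                       λ h′ h′∈M _ →
                         toWitness (Equivalence.from T-≡ (trans (isYes≗does (h′ ≟ᶠ h)) h′∈M)) }

C₂-non-simple : ¬ IsSimple C₂
C₂-non-simple simple = simple zero (suc zero) ((λ ()) , inj₁ refl)

C₂-thetaFree : ThetaFree C₂
C₂-thetaFree (H , _) with theta⇒3≤m H
... | s≤s (s≤s ())

corollary13 : (∀ (G : Graph) → MatchingCovered G → ¬ IsSimple G → ThetaFree G → G ≅ C₂)
              × (MatchingCovered C₂ × ¬ IsSimple C₂ × ThetaFree C₂)
corollary13 = only-C₂ , C₂-matchingCovered , C₂-non-simple , C₂-thetaFree
  where
  only-C₂ : ∀ G → MatchingCovered G → ¬ IsSimple G → ThetaFree G → G ≅ C₂
  only-C₂ G (2≤n , connected , matched) non-simple theta-free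
    with GraphProperties.¬IsSimple⇒parallel-edges G non-simple
  ... | e , f , _ , _ , e≢f , e-uv , f-uv
    with m≤n⇒m<n∨m≡n 2≤n | m≤n⇒m<n∨m≡n (distinct₂⇒2≤ e≢f)
  ... | inj₁ 3≤n | _        =
    ⊥-elim (theta-free (≥3-vertices⇒conformalTheta connected matched 3≤n e≢f e-uv f-uv))
  ... | inj₂ 2≡n | inj₁ 3≤m =
    ⊥-elim (theta-free (≥3-edges⇒conformalTheta (sym 2≡n) 3≤m e≢f e-uv f-uv))
  ... | inj₂ 2≡n | inj₂ 2≡m = two-vertices-two-edges⇒≅C₂ G (sym 2≡n) (sym 2≡m)
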